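{- Let $G$ be a graph with at least one vertex that has property $\mathsf{R}$. Then for every feedback vertex set $X$ of $G$, strictly more than $\frac{|E(G)|}{5}$ of the edges of $G$ have at least one endpoint in $X$.
   Context: A graph $G$ has property $\mathsf{R}$ if its minimum degree is at least $2$ and no two adjacent vertices of $G$ both have degree exactly $2$. A feedback vertex set of $G$ is a set $X\subseteq V(G)$ such that $G-X$ is a forest. -}

module Defs where

open import Data.Nat using (ℕ; zero; suc; _+_; _≤_; _<ᵇ_)
open import Data.Bool using (Bool; true; false; _∧_; _∨_; if_then_else_)
open import Data.Fin using (Fin; zero; suc; toℕ)
open import Data.Fin.Subset using (Subset; _∈_; _∉_)
open import Data.List using (List; []; _∷_; length; _∷ʳ_)
open import Data.List.Relation.Unary.All using (All)
open import Data.List.Relation.Unary.Linked using (Linked)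
open import Data.List.Relation.Unary.Unique.Propositional using (Unique)
open import Data.Vec using (lookup)
open import Data.Product using (Σ; _×_; ∃)
open import Relation.Binary.PropositionalEquality using (_≡_)
open import Relation.Nullary using (¬_)

record Graph : Set where
  field
    n      : ℕ
    adj    : Fin n → Fin n → Bool
    sym    : ∀ i j → adj i j ≡ adj j i
    irrefl : ∀ i → adj i i ≡ false
open Graph public

Adj : (G : Graph) → Fin (n G) → Fin (n G) → Set
Adj G i j = adj G i j ≡ true

count : ∀ {k} → (Fin k → Bool) → ℕ
count {zero}  p = 0
count {suc k} p = (if p zero then 1 else 0) + count (λ i → p (suc i))

sumF : ∀ {k} → (Fin k → ℕ) → ℕ
sumF {zero}  f = 0
sumF {suc k} f = f zero + sumF (λ i → f (suc i))

degree : (G : Graph) → Fin (n G) → ℕ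
degree G v = count (adj G v)

PropertyR : Graph → Set
PropertyR G =
  (∀ v → 2 ≤ degree G v) ×
  (∀ u v → Adj G u v → ¬ (degree G u ≡ 2 × degree G v ≡ 2))

_∈ᵇ_ : ∀ {k} → Fin k → Subset k → Bool
i ∈ᵇ X = lookup X i

-- |E(G)|: each edge {i,j} counted once via i < j
edgeCount : Graph → ℕ
edgeCount G = sumF λ i → count λ j → adj G i j ∧ (toℕ i <ᵇ toℕ j)

coveredEdgeCount : (G : Graph) → Subset (n G) → ℕ
coveredEdgeCount G X =
  sumF λ i → count λ j → adj G i j ∧ (toℕ i <ᵇ toℕ j) ∧ (i ∈ᵇ X ∨ j ∈ᵇ X)

-- a cycle of G - X: distinct vertices x, v1, ..., vk (k ≥ 2, so length ≥ 3),
-- all outside X, consecutive ones adjacent, and vk adjacent to x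
record CycleAvoiding (G : Graph) (X : Subset (n G)) : Set where
  field
    x       : Fin (n G)
    xs      : List (Fin (n G))
    long    : 2 ≤ length xs
    distinct : Unique (x ∷ xs)
    closed  : Linked (Adj G) ((x ∷ xs) ∷ʳ x)
    outside : All (_∉ X) (x ∷ xs)

FeedbackVertexSet : (G : Graph) → Subset (n G) → Set
FeedbackVertexSet G X = ¬ CycleAvoiding G X

module Submission where

-- F = G - X is a forest on n vertices. Call a vertex of F bad if it has degree 2 in G and both
-- neighbours in F. Every other vertex of F has degree at least 3 or an edge into X, so summing
-- degrees over F gives 3n ≤ 2d + 2e(F) + b, with d the number of F–X edges and b the number of
-- bad vertices. Property R makes bad vertices pairwise non-adjacent, so the 2b edges of F at bad
-- vertices form a forest on at most n vertices: 2b ≤ n - 1; also e(F) ≤ n - 1. Eliminating n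
-- and b gives e(F) + 6 ≤ 4d ≤ 4c for the number c of covered edges, and |E| = e(F) + c < 5c.
-- If X contains every vertex, then |E| = c, and c > 0 by the minimum degree.

open import Data.Bool using (Bool; true; false; _∧_; _∨_; not; if_then_else_; T)
open import Data.Bool.Properties using (∧-comm; ∧-assoc; ∨-comm; ∧-zeroʳ; ∧-conicalˡ; ∧-conicalʳ)
open import Data.Empty using (⊥; ⊥-elim)
open import Data.Fin using (Fin; zero; suc; toℕ; fromℕ<; punchIn; _≟_)
open import Data.Fin.Properties using (any?; punchInᵢ≢i; pigeonhole) renaming (<⇒≢ to <⇒≢ᶠ)
open import Data.Fin.Subset using (Subset; _∉_)
open import Data.List using (List; []; _∷_; length; lookup; _++_; _∷ʳ_; [_])
open import Data.List.Properties using (length-++; ++-assoc)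
open import Data.List.Membership.Propositional using (_∈_)
open import Data.List.Membership.Propositional.Properties using (∈-lookup; ∈-∃++)
open import Data.List.Relation.Unary.All as All using (All; []; _∷_)
open import Data.List.Relation.Unary.All.Properties using (¬Any⇒All¬) renaming (++⁻ˡ to All-++⁻ˡ)
open import Data.List.Relation.Unary.AllPairs using ([]; _∷_)
open import Data.List.Relation.Unary.Any using (here; there)
open import Data.List.Relation.Unary.Linked as Linked using (Linked; []; [-]; _∷_)
open import Data.List.Relation.Unary.Unique.Propositional using (Unique)
import Data.Nat as ℕ
open import Data.Nat using (ℕ; zero; suc; _+_; _*_; _≤_; _<_; _<ᵇ_; _≡ᵇ_; _≤?_; z≤n; s≤s)
open import Data.Nat.Properties hiding (_≟_)
open import Algebra.Properties.Semiring.Sum +-*-semiring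
  using (sum; sum-syntax; sum-cong-≗; sum-replicate-zero; sum-remove; ∑-distrib-+; ∑-comm; *-distribˡ-sum)
open import Data.Nat.Tactic.RingSolver using (solve-∀)
open import Data.Product using (∃; _×_; _,_; proj₁; proj₂)
open import Data.Unit using (tt)
open import Data.Vec.Properties using ([]=⇒lookup)
open import Function using (_∘_; flip)
open import Relation.Binary.PropositionalEquality hiding ([_])
open import Relation.Nullary using (¬_; contradiction; yes; no; does)
open import Relation.Nullary.Decidable using (dec-true; dec-false)

open import Defs hiding (sym)

⟦_⟧ : Bool → ℕ
⟦ b ⟧ = if b then 1 else 0

⟦⟧≤1 : ∀ b → ⟦ b ⟧ ≤ 1
⟦⟧≤1 true  = ≤-refl
⟦⟧≤1 false = z≤n

sum-mono-≤ : ∀ {k} {f g : Fin k → ℕ} → (∀ i → f i ≤ g i) → sum f ≤ sum g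
sum-mono-≤ {zero}  h = z≤n
sum-mono-≤ {suc k} h = +-mono-≤ (h zero) (sum-mono-≤ (h ∘ suc))

sum-≡0 : ∀ {k} (f : Fin k → ℕ) → (∀ i → f i ≡ 0) → sum f ≡ 0
sum-≡0 {k} f h = trans (sum-cong-≗ h) (sum-replicate-zero k)

term≤sum : ∀ {k} (f : Fin k → ℕ) i → f i ≤ sum f
term≤sum {suc k} f i = ≤-trans (m≤m+n (f i) _) (≤-reflexive (sym (sum-remove f)))

sum-single : ∀ {k} {f : Fin k → ℕ} i → (∀ j → j ≢ i → f j ≡ 0) → sum f ≡ f i
sum-single {suc k} {f} i h = begin
  sum f                           ≡⟨ sum-remove f ⟩
  f i + sum (f ∘ punchIn i)       ≡⟨ cong (f i +_) (sum-≡0 (f ∘ punchIn i) (λ j → h _ (punchInᵢ≢i i j))) ⟩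
  f i + 0                         ≡⟨ +-identityʳ (f i) ⟩
  f i                             ∎
  where open ≡-Reasoning

positive-term : ∀ {k} (f : Fin k → ℕ) → 0 < sum f → ∃ λ i → 0 < f i
positive-term {suc k} f pos with f zero in eq
... | suc _ = zero , subst (0 <_) (sym eq) (s≤s z≤n)
... | zero with positive-term (f ∘ suc) pos
...   | i , p = suc i , p

count≡sum : ∀ {k} (p : Fin k → Bool) → count p ≡ ∑[ i < k ] ⟦ p i ⟧
count≡sum {zero}  p = refl
count≡sum {suc k} p = cong (⟦ p zero ⟧ +_) (count≡sum (p ∘ suc))

sumF≡sum : ∀ {k} (f : Fin k → ℕ) → sumF f ≡ sum f
sumF≡sum {zero}  f = refl
sumF≡sum {suc k} f = cong (f zero +_) (sumF≡sum (f ∘ suc))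

size : ∀ {k} → (Fin k → Bool) → ℕ
size {k} P = ∑[ i < k ] ⟦ P i ⟧

size-pos⇒∃ : ∀ {k} (P : Fin k → Bool) → 0 < size P → ∃ λ i → P i ≡ true
size-pos⇒∃ P pos with positive-term (⟦_⟧ ∘ P) pos
... | i , p with P i in eq
...   | true = i , eq

size≥2⇒∃≢ : ∀ {k} (P : Fin k → Bool) → 2 ≤ size P → ∀ p → ∃ λ u → u ≢ p × P u ≡ true
size≥2⇒∃≢ {suc k} P two p with size-pos⇒∃ (P ∘ punchIn p) rest-pos
  where
  rest-pos : 1 ≤ size (P ∘ punchIn p)
  rest-pos = +-cancelˡ-≤ 1 1 _ (≤-trans two (≤-trans (≤-reflexive (sum-remove (⟦_⟧ ∘ P)))
               (+-monoˡ-≤ _ (⟦⟧≤1 (P p)))))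
... | j , Pu = punchIn p j , punchInᵢ≢i p j , Pu

size≡0⇒false : ∀ {k} (P : Fin k → Bool) → size P ≡ 0 → ∀ i → P i ≡ false
size≡0⇒false P empty i with P i in eq
... | false = refl
... | true with subst (1 ≤_) empty (subst (λ b → ⟦ b ⟧ ≤ size P) eq (term≤sum (⟦_⟧ ∘ P) i))
...   | ()

pairCount : ∀ {k} → (Fin k → Fin k → Bool) → ℕ
pairCount {k} R = ∑[ i < k ] size (R i)

module _ {k : ℕ} where

  pairCount-split : {R S T : Fin k → Fin k → Bool} → (∀ i j → ⟦ R i j ⟧ ≡ ⟦ S i j ⟧ + ⟦ T i j ⟧) →
                    pairCount R ≡ pairCount S + pairCount T
  pairCount-split {S = S} {T} h =
    trans (sum-cong-≗ λ i → trans (sum-cong-≗ (h i)) (∑-distrib-+ (⟦_⟧ ∘ S i) (⟦_⟧ ∘ T i)))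
          (∑-distrib-+ (size ∘ S) (size ∘ T))

  pairCount-mono : {R S : Fin k → Fin k → Bool} → (∀ i j → ⟦ R i j ⟧ ≤ ⟦ S i j ⟧) →
                   pairCount R ≤ pairCount S
  pairCount-mono h = sum-mono-≤ λ i → sum-mono-≤ (h i)

  pairCount-transpose : (R : Fin k → Fin k → Bool) → pairCount (flip R) ≡ pairCount R
  pairCount-transpose R = sym (∑-comm λ i j → ⟦ R i j ⟧)

  pairCount-double : {R T : Fin k → Fin k → Bool} → (∀ i j → ⟦ R i j ⟧ ≡ ⟦ T i j ⟧ + ⟦ T j i ⟧) →
                     pairCount R ≡ 2 * pairCount T
  pairCount-double {R} {T} h = begin
    pairCount R                          ≡⟨ pairCount-split h ⟩
    pairCount T + pairCount (flip T)     ≡⟨ cong (pairCount T +_) (pairCount-transpose T) ⟩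
    pairCount T + pairCount T            ≡⟨ cong (pairCount T +_) (+-identityʳ _) ⟨
    2 * pairCount T                      ∎
    where open ≡-Reasoning

sumF-count≡pairCount : ∀ {k} (R : Fin k → Fin k → Bool) → sumF (λ i → count (R i)) ≡ pairCount R
sumF-count≡pairCount R = trans (sumF≡sum (count ∘ R)) (sum-cong-≗ λ i → count≡sum (R i))

deg : (G : Graph) → Fin (n G) → ℕ
deg G v = size (adj G v)

arcs : Graph → ℕ
arcs G = pairCount (adj G)

degreeSum : (G : Graph) → (Fin (n G) → Bool) → ℕ
degreeSum G Q = pairCount λ i j → Q i ∧ adj G i j

restrict : (G : Graph) (S : Fin (n G) → Fin (n G) → Bool) → (∀ i j → S i j ≡ S j i) → Graph
restrict G S S-sym = record
  { n      = n G
  ; adj    = λ i j → adj G i j ∧ S i j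
  ; sym    = λ i j → cong₂ _∧_ (Graph.sym G i j) (S-sym i j)
  ; irrefl = λ i → cong (_∧ S i i) (irrefl G i)
  }

induced : (G : Graph) → (Fin (n G) → Bool) → Graph
induced G P = restrict G (λ i j → P i ∧ P j) (λ i j → ∧-comm (P i) (P j))

touching : (G : Graph) → (Fin (n G) → Bool) → Graph
touching G P = restrict G (λ i j → P i ∨ P j) (λ i j → ∨-comm (P i) (P j))

module _ (G : Graph) where

  degree≡deg : ∀ v → degree G v ≡ deg G v
  degree≡deg v = count≡sum (adj G v)

  deg-split : (Q : Fin (n G) → Bool) → ∀ v → deg G v ≡ deg (induced G (not ∘ Q)) v + deg (touching G Q) v
  deg-split Q v = trans (sum-cong-≗ λ j → split (adj G v j) (Q v) (Q j))
                        (∑-distrib-+ (⟦_⟧ ∘ adj (induced G (not ∘ Q)) v) (⟦_⟧ ∘ adj (touching G Q) v))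
    where
    split : ∀ a p q → ⟦ a ⟧ ≡ ⟦ a ∧ (not p ∧ not q) ⟧ + ⟦ a ∧ (p ∨ q) ⟧
    split false _     _     = refl
    split true  false false = refl
    split true  false true  = refl
    split true  true  _     = refl

  arcs-split : (Q : Fin (n G) → Bool) → arcs G ≡ arcs (induced G (not ∘ Q)) + arcs (touching G Q)
  arcs-split Q = trans (sum-cong-≗ (deg-split Q))
                       (∑-distrib-+ (deg (induced G (not ∘ Q))) (deg (touching G Q)))

  arcs-restrict≤ : ∀ S S-sym → arcs (restrict G S S-sym) ≤ arcs G
  arcs-restrict≤ S _ = pairCount-mono λ i j → ∧-⟦⟧≤ (adj G i j) (S i j)
    where
    ∧-⟦⟧≤ : ∀ a b → ⟦ a ∧ b ⟧ ≤ ⟦ a ⟧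
    ∧-⟦⟧≤ false _ = z≤n
    ∧-⟦⟧≤ true  b = ⟦⟧≤1 b

  arcs-touching : (Q : Fin (n G) → Bool) → (∀ i j → Adj G i j → Q i ≡ true → Q j ≡ false) →
                  arcs (touching G Q) ≡ 2 * degreeSum G Q
  arcs-touching Q independent = pairCount-double pointwise
    where
    pointwise : ∀ i j → ⟦ adj G i j ∧ (Q i ∨ Q j) ⟧ ≡ ⟦ Q i ∧ adj G i j ⟧ + ⟦ Q j ∧ adj G j i ⟧
    pointwise i j rewrite Graph.sym G j i with adj G i j in ij | Q i in qi | Q j in qj
    ... | false | false | false = refl
    ... | false | false | true  = refl
    ... | false | true  | false = refl
    ... | false | true  | true  = refl
    ... | true  | false | false = refl
    ... | true  | false | true  = refl
    ... | true  | true  | false = refl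
    ... | true  | true  | true  with trans (sym qj) (independent i j ij qi)
    ...   | ()

  handshake : arcs G ≡ 2 * edgeCount G
  handshake = trans (pairCount-double pointwise) (cong (2 *_) (sym (sumF-count≡pairCount λ i j → adj G i j ∧ (toℕ i <ᵇ toℕ j))))
    where
    exactly-one-< : ∀ {k} (i j : Fin k) → i ≢ j → ⟦ toℕ i <ᵇ toℕ j ⟧ + ⟦ toℕ j <ᵇ toℕ i ⟧ ≡ 1
    exactly-one-< zero    zero    i≢j = contradiction refl i≢j
    exactly-one-< zero    (suc j) _   = refl
    exactly-one-< (suc i) zero    _   = refl
    exactly-one-< (suc i) (suc j) i≢j = exactly-one-< i j (i≢j ∘ cong suc)

    loopless : ∀ {i j} → Adj G i j → i ≢ j
    loopless {i} ij refl with trans (sym ij) (irrefl G i)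
    ... | ()

    pointwise : ∀ i j → ⟦ adj G i j ⟧ ≡ ⟦ adj G i j ∧ (toℕ i <ᵇ toℕ j) ⟧ + ⟦ adj G j i ∧ (toℕ j <ᵇ toℕ i) ⟧
    pointwise i j rewrite Graph.sym G j i with adj G i j in ij
    ... | false = refl
    ... | true  = sym (exactly-one-< i j (loopless ij))

Unique⇒lookup-injective : ∀ {A : Set} {xs : List A} → Unique xs → ∀ i j → lookup xs i ≡ lookup xs j → i ≡ j
Unique⇒lookup-injective (_ ∷ _)        zero    zero    _ = refl
Unique⇒lookup-injective (x∉xs ∷ _)     zero    (suc j) e = contradiction e (All.lookup x∉xs (∈-lookup j))
Unique⇒lookup-injective (x∉xs ∷ _)     (suc i) zero    e = contradiction (sym e) (All.lookup x∉xs (∈-lookup i))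
Unique⇒lookup-injective (_ ∷ distinct) (suc i) (suc j) e = cong suc (Unique⇒lookup-injective distinct i j e)

Unique⇒length≤ : ∀ {k} {xs : List (Fin k)} → Unique xs → length xs ≤ k
Unique⇒length≤ {k} {xs} distinct with length xs ≤? k
... | yes fits = fits
... | no too-long with i , j , i<j , same ← pigeonhole (≰⇒> too-long) (lookup xs) =
  contradiction (Unique⇒lookup-injective distinct i j same) (<⇒≢ᶠ i<j)

Unique-++⁻ˡ : ∀ {A : Set} (xs : List A) {ys} → Unique (xs ++ ys) → Unique xs
Unique-++⁻ˡ []       _              = []
Unique-++⁻ˡ (x ∷ xs) (x∉ ∷ distinct) = All-++⁻ˡ xs x∉ ∷ Unique-++⁻ˡ xs distinct

module _ {A : Set} {R : A → A → Set} where

  Linked-++⁻ˡ : ∀ xs {ys} → Linked R (xs ++ ys) → Linked R xs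
  Linked-++⁻ˡ []           _       = []
  Linked-++⁻ˡ (x ∷ [])     _       = [-]
  Linked-++⁻ˡ (x ∷ y ∷ xs) (r ∷ l) = r ∷ Linked-++⁻ˡ (y ∷ xs) l

  Linked-∷ʳ⁺ : ∀ xs {y z} → Linked R (xs ∷ʳ y) → R y z → Linked R ((xs ∷ʳ y) ∷ʳ z)
  Linked-∷ʳ⁺ []           _       r′ = r′ ∷ [-]
  Linked-∷ʳ⁺ (x ∷ [])     (r ∷ _) r′ = r ∷ r′ ∷ [-]
  Linked-∷ʳ⁺ (x ∷ y ∷ xs) (r ∷ l) r′ = r ∷ Linked-∷ʳ⁺ (y ∷ xs) l r′

  Linked-∷ʳ⇒All : {P : A → Set} → (∀ {a b} → R a b → P a) → ∀ xs {y} → Linked R (xs ∷ʳ y) → All P xs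
  Linked-∷ʳ⇒All source []           _       = []
  Linked-∷ʳ⇒All source (x ∷ [])     (r ∷ _) = source r ∷ []
  Linked-∷ʳ⇒All source (x ∷ y ∷ xs) (r ∷ l) = source r ∷ Linked-∷ʳ⇒All source (y ∷ xs) l

Acyclic : Graph → Set
Acyclic G = ∀ {x xs} → 2 ≤ length xs → Unique (x ∷ xs) → ¬ Linked (Adj G) ((x ∷ xs) ∷ʳ x)

restrict-acyclic : ∀ G S S-sym → Acyclic G → Acyclic (restrict G S S-sym)
restrict-acyclic G S _ acyclic long distinct closed =
  acyclic long distinct (Linked.map (∧-conicalˡ _ _) closed)

fvs⇒acyclic : ∀ G X → FeedbackVertexSet G X → Acyclic (induced G (λ i → not (i ∈ᵇ X)))
fvs⇒acyclic G X fvs {x} {xs} long distinct closed = fvs record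
  { x        = x
  ; xs       = xs
  ; long     = long
  ; distinct = distinct
  ; closed   = Linked.map (∧-conicalˡ _ _) closed
  ; outside  = Linked-∷ʳ⇒All source (x ∷ xs) closed
  }
  where
  source : ∀ {a b} → adj G a b ∧ (not (a ∈ᵇ X) ∧ not (b ∈ᵇ X)) ≡ true → a ∉ X
  source {a} {b} e a∈X
    with subst (λ c → not c ≡ true) ([]=⇒lookup a∈X) (∧-conicalˡ _ _ (∧-conicalʳ (adj G a b) _ e))
  ... | ()

module _ (G : Graph) (acyclic : Acyclic G) (leafless : ∀ v → deg G v ≢ 1) where

  open import Data.List.Membership.DecPropositional (_≟_ {n G}) using (_∈?_)

  private
    -- newest vertex first
    Path : List (Fin (n G)) → Set
    Path ps = Unique ps × Linked (Adj G) ps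

    adj-sym : ∀ {i j} → Adj G i j → Adj G j i
    adj-sym {i} {j} ij = trans (Graph.sym G j i) ij

    adj⇒≢ : ∀ {i j} → Adj G i j → j ≢ i
    adj⇒≢ {i} ij refl with trans (sym ij) (irrefl G i)
    ... | ()

    adj⇒deg≥2 : ∀ {w p} → Adj G w p → 2 ≤ deg G w
    adj⇒deg≥2 {w} {p} wp =
      ≤∧≢⇒< (subst (λ b → ⟦ b ⟧ ≤ deg G w) wp (term≤sum (⟦_⟧ ∘ adj G w) p)) (leafless w ∘ sym)

  chord⇒⊥ : ∀ {w p rest u} → Path (w ∷ p ∷ rest) → u ∈ rest → Adj G u w → ⊥
  chord⇒⊥ {w} {p} {rest} {u} (distinct , path) u∈rest uw
    with ys , zs , refl ← ∈-∃++ u∈rest =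
    acyclic long (Unique-++⁻ˡ cycle (subst Unique split distinct))
                 (Linked-∷ʳ⁺ (w ∷ p ∷ ys) (Linked-++⁻ˡ cycle (subst (Linked (Adj G)) split path)) uw)
    where
    cycle : List (Fin (n G))
    cycle = w ∷ p ∷ ys ∷ʳ u
    split : w ∷ p ∷ ys ++ u ∷ zs ≡ cycle ++ zs
    split = cong (λ l → w ∷ p ∷ l) (sym (++-assoc ys [ u ] zs))
    long : 2 ≤ length (p ∷ ys ∷ʳ u)
    long = s≤s (≤-trans (m≤n+m 1 (length ys)) (≤-reflexive (sym (length-++ ys))))

  -- Leaving the newest vertex by an edge other than the one just used never revisits the path,
  -- so a path could be extended forever, which the finitely many vertices forbid.
  extend : ∀ fuel {w p rest} → Path (w ∷ p ∷ rest) → n G < fuel + length (w ∷ p ∷ rest) → ⊥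
  extend zero (distinct , _) bound = <⇒≱ bound (Unique⇒length≤ distinct)
  extend (suc fuel) {w} {p} {rest} (distinct , path) bound
    with u , u≢p , wu ← size≥2⇒∃≢ (adj G w) (adj⇒deg≥2 (Linked.head path)) p
    with u ∈? (p ∷ rest)
  ... | no u∉  = extend fuel ((adj⇒≢ wu ∷ ¬Any⇒All¬ _ u∉) ∷ distinct , adj-sym wu ∷ path)
                        (subst (n G <_) (sym (+-suc fuel _)) bound)
  ... | yes (here u≡p)     = u≢p u≡p
  ... | yes (there u∈rest) = chord⇒⊥ (distinct , path) u∈rest (adj-sym wu)

  leafless-acyclic⇒edgeless : ∀ i j → adj G i j ≡ false
  leafless-acyclic⇒edgeless i j with adj G i j in ij
  ... | false = refl
  ... | true  = ⊥-elim (extend (n G) ((adj⇒≢ ij ∷ []) ∷ [] ∷ [] , adj-sym ij ∷ [-])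
                                (subst (n G <_) (sym (+-comm (n G) 2)) (n≤1+n (suc (n G)))))

_≟ᵇ_ _≢ᵇ_ : ∀ {k} → Fin k → Fin k → Bool
i ≟ᵇ v = does (i ≟ v)
i ≢ᵇ v = not (i ≟ᵇ v)

_─_ : (G : Graph) → Fin (n G) → Graph
G ─ v = induced G (_≢ᵇ v)

arcs-delete : ∀ G v → arcs G ≡ arcs (G ─ v) + 2 * deg G v
arcs-delete G v = begin
  arcs G                                         ≡⟨ arcs-split G (_≟ᵇ v) ⟩
  arcs (G ─ v) + arcs (touching G (_≟ᵇ v))       ≡⟨ cong (arcs (G ─ v) +_) (arcs-touching G (_≟ᵇ v) only-v) ⟩
  arcs (G ─ v) + 2 * degreeSum G (_≟ᵇ v)         ≡⟨ cong (λ d → arcs (G ─ v) + 2 * d) (sum-single v row) ⟩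
  arcs (G ─ v) + 2 * size (λ j → v ≟ᵇ v ∧ adj G v j)
    ≡⟨ cong (λ b → arcs (G ─ v) + 2 * size (λ j → b ∧ adj G v j)) (dec-true (v ≟ v) refl) ⟩
  arcs (G ─ v) + 2 * deg G v                     ∎
  where
  open ≡-Reasoning
  only-v : ∀ i j → Adj G i j → i ≟ᵇ v ≡ true → j ≟ᵇ v ≡ false
  only-v i j ij _ with i ≟ v | j ≟ v
  ... | yes refl | yes refl with trans (sym ij) (irrefl G i)
  ...   | ()
  only-v i j ij _ | _ | no _ = refl
  row : ∀ i → i ≢ v → size (λ j → i ≟ᵇ v ∧ adj G i j) ≡ 0
  row i i≢v rewrite dec-false (i ≟ v) i≢v = sum-≡0 {n G} (λ _ → 0) λ _ → refl

size-delete : ∀ {k} (P : Fin k → Bool) v → P v ≡ true → size P ≡ suc (size λ i → P i ∧ i ≢ᵇ v)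
size-delete P v Pv = begin
  size P                                        ≡⟨ split ⟩
  size P′ + size (λ i → i ≟ᵇ v ∧ P i)           ≡⟨ cong (size P′ +_) (sum-single v only-v) ⟩
  size P′ + ⟦ v ≟ᵇ v ∧ P v ⟧                    ≡⟨ cong₂ (λ a b → size P′ + ⟦ a ∧ b ⟧) (dec-true (v ≟ v) refl) Pv ⟩
  size P′ + 1                                   ≡⟨ +-comm (size P′) 1 ⟩
  suc (size P′)                                 ∎
  where
  open ≡-Reasoning
  P′ = λ i → P i ∧ i ≢ᵇ v
  ⟦⟧-split : ∀ p q → ⟦ p ⟧ ≡ ⟦ p ∧ not q ⟧ + ⟦ q ∧ p ⟧
  ⟦⟧-split false false = refl
  ⟦⟧-split false true  = refl
  ⟦⟧-split true  false = refl
  ⟦⟧-split true  true  = refl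
  split : size P ≡ size P′ + size (λ i → i ≟ᵇ v ∧ P i)
  split = trans (sum-cong-≗ λ i → ⟦⟧-split (P i) (i ≟ᵇ v)) (∑-distrib-+ (⟦_⟧ ∘ P′) (λ i → ⟦ i ≟ᵇ v ∧ P i ⟧))
  only-v : ∀ i → i ≢ v → ⟦ i ≟ᵇ v ∧ P i ⟧ ≡ 0
  only-v i i≢v rewrite dec-false (i ≟ v) i≢v = refl

module LeafDeletion (H : Graph) (P : Fin (n H) → Bool) (covers : ∀ i j → Adj H i j → P i ≡ true)
                    {v u : Fin (n H)} (vu : Adj H v u) where

  P′ : Fin (n H) → Bool
  P′ i = P i ∧ i ≢ᵇ v

  size-P′ : size P ≡ suc (size P′)
  size-P′ = size-delete P v (covers v u vu)

  covers′ : ∀ i j → Adj (H ─ v) i j → P′ i ≡ true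
  covers′ i j e = cong₂ _∧_ (covers i j (∧-conicalˡ _ _ e)) (∧-conicalˡ _ _ (∧-conicalʳ (adj H i j) _ e))

  P′u : P′ u ≡ true
  P′u = cong₂ _∧_ (covers u v (trans (Graph.sym H u v) vu)) (cong not (dec-false (u ≟ v) u≢v))
    where
    u≢v : u ≢ v
    u≢v refl with trans (sym vu) (irrefl H u)
    ... | ()

forest-bound : ∀ m (H : Graph) (P : Fin (n H) → Bool) → Acyclic H → (∀ i j → Adj H i j → P i ≡ true) →
               size P ≡ suc m → arcs H + 2 ≤ 2 * size P
forest-bound m H P acyclic covers |P| with any? (λ v → deg H v ℕ.≟ 1)
... | no leafless = begin
  arcs H + 2   ≡⟨ cong (_+ 2) edgeless ⟩
  2            ≤⟨ *-monoʳ-≤ 2 (≤-trans (s≤s z≤n) (≤-reflexive (sym |P|))) ⟩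
  2 * size P   ∎
  where
  open ≤-Reasoning
  edgeless : arcs H ≡ 0
  edgeless = sum-≡0 (deg H) λ i → sum-≡0 (⟦_⟧ ∘ adj H i) λ j →
    cong ⟦_⟧ (leafless-acyclic⇒edgeless H acyclic (λ v leaf → leafless (v , leaf)) i j)
forest-bound m H P acyclic covers |P| | yes (v , leaf) with size-pos⇒∃ (adj H v) (≤-reflexive (sym leaf))
forest-bound zero H P acyclic covers |P| | yes (v , leaf) | u , vu =
  contradiction (trans (sym P′u) (size≡0⇒false P′ (suc-injective (trans (sym size-P′) |P|)) u)) λ ()
  where open LeafDeletion H P covers vu
forest-bound (suc m) H P acyclic covers |P| | yes (v , leaf) | u , vu = begin
  arcs H + 2                    ≡⟨ cong (_+ 2) (arcs-delete H v) ⟩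
  arcs (H ─ v) + 2 * deg H v + 2 ≡⟨ cong (λ d → arcs (H ─ v) + 2 * d + 2) leaf ⟩
  arcs (H ─ v) + 2 + 2          ≤⟨ +-monoˡ-≤ 2 (forest-bound m (H ─ v) P′ acyclic′ covers′ |P′|) ⟩
  2 * size P′ + 2               ≡⟨ +-comm (2 * size P′) 2 ⟩
  2 + 2 * size P′               ≡⟨ *-suc 2 (size P′) ⟨
  2 * suc (size P′)             ≡⟨ cong (2 *_) size-P′ ⟨
  2 * size P                    ∎
  where
  open ≤-Reasoning
  open LeafDeletion H P covers vu
  acyclic′ : Acyclic (H ─ v)
  acyclic′ = restrict-acyclic H _ (λ i j → ∧-comm (i ≢ᵇ v) (j ≢ᵇ v)) acyclic
  |P′| : size P′ ≡ suc m
  |P′| = suc-injective (trans (sym size-P′) |P|)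

counting : ∀ {e c eF nF b d} → eF + 2 ≤ 2 * nF → 4 * b + 2 ≤ 2 * nF → 3 * nF ≤ 2 * d + eF + b → d ≤ c →
           2 * e ≡ eF + 2 * c → e < 5 * c
counting {e} {c} {eF} {nF} {b} {d} forest bad-forest degrees d≤c edges = *-cancelˡ-≤ 2 (begin
  2 * suc e           ≡⟨ *-suc 2 e ⟩
  2 + 2 * e           ≤⟨ +-monoˡ-≤ (2 * e) (m≤m+n 2 10) ⟩
  12 + 2 * e          ≡⟨ cong (12 +_) edges ⟩
  12 + (eF + 2 * c)   ≡⟨ +-assoc 12 eF (2 * c) ⟨
  12 + eF + 2 * c     ≤⟨ +-monoˡ-≤ (2 * c) 12+eF≤8c ⟩
  8 * c + 2 * c       ≡⟨ *-distribʳ-+ c 8 2 ⟨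
  10 * c              ≡⟨ *-assoc 2 5 c ⟩
  2 * (5 * c)         ∎)
  where
  open ≤-Reasoning
  rest = 4 * eF + 12 * nF + 4 * b + 8 * d
  -- 5 forest + bad-forest + 4 degrees + 8 d≤c; all other terms cancel
  combined : 12 + eF + rest ≤ 8 * c + rest
  combined = begin
    12 + eF + rest                                         ≡⟨ lhs eF nF b d ⟩
    5 * (eF + 2) + (4 * b + 2) + 4 * (3 * nF) + 8 * d      ≤⟨ +-mono-≤ (+-mono-≤ (+-mono-≤ (*-monoʳ-≤ 5 forest) bad-forest)
                                                                 (*-monoʳ-≤ 4 degrees)) (*-monoʳ-≤ 8 d≤c) ⟩
    5 * (2 * nF) + 2 * nF + 4 * (2 * d + eF + b) + 8 * c   ≡⟨ rhs eF nF b d c ⟩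
    8 * c + rest                                           ∎
    where
    lhs : ∀ eF nF b d → 12 + eF + (4 * eF + 12 * nF + 4 * b + 8 * d) ≡ 5 * (eF + 2) + (4 * b + 2) + 4 * (3 * nF) + 8 * d
    lhs = solve-∀
    rhs : ∀ eF nF b d c → 5 * (2 * nF) + 2 * nF + 4 * (2 * d + eF + b) + 8 * c ≡ 8 * c + (4 * eF + 12 * nF + 4 * b + 8 * d)
    rhs = solve-∀
  12+eF≤8c : 12 + eF ≤ 8 * c
  12+eF≤8c = +-cancelʳ-≤ rest (12 + eF) (8 * c) combined

module Covering (G : Graph) (X : Subset (n G)) where

  out : Fin (n G) → Bool
  out i = not (i ∈ᵇ X)

  F Cov : Graph
  F   = induced G out
  Cov = touching G (_∈ᵇ X)

  bad : Fin (n G) → Bool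
  bad i = out i ∧ (deg F i ≡ᵇ 2) ∧ (deg Cov i ≡ᵇ 0)

  Bad : Graph
  Bad = touching F bad

  F-covers : ∀ i j → Adj F i j → out i ≡ true
  F-covers i j e = ∧-conicalˡ _ _ (∧-conicalʳ (adj G i j) _ e)

  covered≡edgeCount : coveredEdgeCount G X ≡ edgeCount Cov
  covered≡edgeCount = begin
    coveredEdgeCount G X                                             ≡⟨ sumF-count≡pairCount (λ i j → adj G i j ∧ (lt i j ∧ (i ∈ᵇ X ∨ j ∈ᵇ X))) ⟩
    pairCount (λ i j → adj G i j ∧ (lt i j ∧ (i ∈ᵇ X ∨ j ∈ᵇ X)))      ≡⟨ sum-cong-≗ (λ i → sum-cong-≗ λ j → cong ⟦_⟧ (reorder (adj G i j) _ _)) ⟩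
    pairCount (λ i j → (adj G i j ∧ (i ∈ᵇ X ∨ j ∈ᵇ X)) ∧ lt i j)      ≡⟨ sumF-count≡pairCount (λ i j → (adj G i j ∧ (i ∈ᵇ X ∨ j ∈ᵇ X)) ∧ lt i j) ⟨
    edgeCount Cov                                                    ∎
    where
    open ≡-Reasoning
    lt : Fin (n G) → Fin (n G) → Bool
    lt i j = toℕ i <ᵇ toℕ j
    reorder : ∀ a l c → a ∧ (l ∧ c) ≡ (a ∧ c) ∧ l
    reorder a l c = trans (cong (a ∧_) (∧-comm l c)) (sym (∧-assoc a c l))

  edges≡forest+covered : 2 * edgeCount G ≡ arcs F + 2 * coveredEdgeCount G X
  edges≡forest+covered = begin
    2 * edgeCount G                  ≡⟨ handshake G ⟨
    arcs G                           ≡⟨ arcs-split G (_∈ᵇ X) ⟩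
    arcs F + arcs Cov                ≡⟨ cong (arcs F +_) (handshake Cov) ⟩
    arcs F + 2 * edgeCount Cov       ≡⟨ cong (λ c → arcs F + 2 * c) covered≡edgeCount ⟨
    arcs F + 2 * coveredEdgeCount G X ∎
    where open ≡-Reasoning

  deg-G : ∀ i → deg G i ≡ deg F i + deg Cov i
  deg-G = deg-split G (_∈ᵇ X)

  bad⇒degrees : ∀ {i} → bad i ≡ true → deg F i ≡ 2 × deg Cov i ≡ 0
  bad⇒degrees {i} e = ≡ᵇ-true⇒≡ (∧-conicalˡ _ _ e′) , ≡ᵇ-true⇒≡ (∧-conicalʳ _ _ e′)
    where
    e′ = ∧-conicalʳ (out i) _ e
    ≡ᵇ-true⇒≡ : ∀ {m k} → (m ≡ᵇ k) ≡ true → m ≡ k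
    ≡ᵇ-true⇒≡ {m} {k} e = ≡ᵇ⇒≡ m k (subst T (sym e) tt)

  forest : FeedbackVertexSet G X → ∀ {m} → size out ≡ suc m → arcs F + 2 ≤ 2 * size out
  forest fvs {m} = forest-bound m F out (fvs⇒acyclic G X fvs) F-covers

  bad-forest : PropertyR G → FeedbackVertexSet G X → ∀ {m} → size out ≡ suc m → 4 * size bad + 2 ≤ 2 * size out
  bad-forest PR fvs {m} |out| = subst (λ a → a + 2 ≤ 2 * size out) arcs-Bad
    (forest-bound m Bad out (restrict-acyclic F _ (λ i j → ∨-comm (bad i) (bad j)) (fvs⇒acyclic G X fvs))
                  (λ i j e → F-covers i j (∧-conicalˡ _ _ e)) |out|)
    where
    degree-2 : ∀ {i} → bad i ≡ true → degree G i ≡ 2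
    degree-2 {i} e with bad⇒degrees e
    ... | dF , dCov = trans (degree≡deg G i) (trans (deg-G i) (cong₂ _+_ dF dCov))

    independent : ∀ i j → Adj F i j → bad i ≡ true → bad j ≡ false
    independent i j ij bi with bad j in bj
    ... | false = refl
    ... | true  = ⊥-elim (proj₂ PR i j (∧-conicalˡ _ _ ij) (degree-2 bi , degree-2 bj))

    row : ∀ i → size (λ j → bad i ∧ adj F i j) ≡ 2 * ⟦ bad i ⟧
    row i with bad i in bi
    ... | true  = proj₁ (bad⇒degrees bi)
    ... | false = sum-≡0 {n G} (λ _ → 0) λ _ → refl

    arcs-Bad : arcs Bad ≡ 4 * size bad
    arcs-Bad = begin
      arcs Bad                 ≡⟨ arcs-touching F bad independent ⟩
      2 * degreeSum F bad      ≡⟨ cong (2 *_) (trans (sum-cong-≗ row) (sym (*-distribˡ-sum 2 (⟦_⟧ ∘ bad)))) ⟩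
      2 * (2 * size bad)       ≡⟨ *-assoc 2 2 (size bad) ⟨
      4 * size bad             ∎
      where open ≡-Reasoning

  degree-count : PropertyR G → 3 * size out ≤ 2 * degreeSum Cov out + arcs F + size bad
  degree-count PR = begin
    3 * size out                                   ≡⟨ *-distribˡ-sum 3 (⟦_⟧ ∘ out) ⟩
    ∑[ i < n G ] (3 * ⟦ out i ⟧)                   ≤⟨ sum-mono-≤ (λ i → pointwise i (min-degree i)) ⟩
    ∑[ i < n G ] (2 * boundary i + deg F i + ⟦ bad i ⟧)
      ≡⟨ ∑-distrib-+ (λ i → 2 * boundary i + deg F i) (⟦_⟧ ∘ bad) ⟩
    ∑[ i < n G ] (2 * boundary i + deg F i) + size bad
      ≡⟨ cong (_+ size bad) (∑-distrib-+ (λ i → 2 * boundary i) (deg F)) ⟩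
    ∑[ i < n G ] (2 * boundary i) + arcs F + size bad
      ≡⟨ cong (λ a → a + arcs F + size bad) (*-distribˡ-sum 2 boundary) ⟨
    2 * degreeSum Cov out + arcs F + size bad      ∎
    where
    open ≤-Reasoning
    boundary : Fin (n G) → ℕ
    boundary i = size λ j → out i ∧ adj Cov i j

    min-degree : ∀ i → 2 ≤ deg F i + deg Cov i
    min-degree i = subst (2 ≤_) (trans (degree≡deg G i) (deg-G i)) (proj₁ PR i)

    vertex-bound : ∀ f c → 2 ≤ f + c → 3 ≤ 2 * c + f + ⟦ (f ≡ᵇ 2) ∧ (c ≡ᵇ 0) ⟧
    vertex-bound 0                   0 ()
    vertex-bound 1                   0 (s≤s ())
    vertex-bound 2                   0 _ = ≤-refl
    vertex-bound (suc (suc (suc f))) 0 _ = s≤s (s≤s (s≤s z≤n))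
    vertex-bound f (suc c) two = ≤-trans (+-mono-≤ (s≤s (z≤n {c})) two) (≤-trans (≤-reflexive (eq f c)) (m≤m+n _ _))
      where
      eq : ∀ f c → suc c + (f + suc c) ≡ 2 * suc c + f
      eq = solve-∀

    pointwise : ∀ i → 2 ≤ deg F i + deg Cov i → 3 * ⟦ out i ⟧ ≤ 2 * boundary i + deg F i + ⟦ bad i ⟧
    pointwise i two with out i
    ... | false = z≤n
    ... | true  = vertex-bound _ (deg Cov i) two

  boundary≤covered : degreeSum Cov out ≤ coveredEdgeCount G X
  boundary≤covered = *-cancelˡ-≤ 2 (begin
    2 * degreeSum Cov out     ≡⟨ arcs-touching Cov out crossing ⟨
    arcs (touching Cov out)   ≤⟨ arcs-restrict≤ Cov _ (λ i j → ∨-comm (out i) (out j)) ⟩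
    arcs Cov                  ≡⟨ handshake Cov ⟩
    2 * edgeCount Cov         ≡⟨ cong (2 *_) covered≡edgeCount ⟨
    2 * coveredEdgeCount G X  ∎)
    where
    open ≤-Reasoning
    crossing : ∀ i j → Adj Cov i j → out i ≡ true → out j ≡ false
    crossing i j e o with i ∈ᵇ X | j ∈ᵇ X | ∧-conicalʳ (adj G i j) _ e
    crossing i j e o  | false | true  | _ = refl
    crossing i j e () | true  | _     | _
    crossing i j e o  | false | false | ()

  all-covered : PropertyR G → 0 < n G → size out ≡ 0 → edgeCount G < 5 * coveredEdgeCount G X
  all-covered PR pos |out| = subst (λ c → edgeCount G < 5 * c) edges≡covered (n<5n edges-pos)
    where
    n<5n : ∀ {e} → 0 < e → e < 5 * e
    n<5n {suc e} _ = m<m+n (suc e) (s≤s z≤n)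

    arcs-F : arcs F ≡ 0
    arcs-F = sum-≡0 (deg F) λ i → sum-≡0 (⟦_⟧ ∘ adj F i) λ j →
      cong ⟦_⟧ (trans (cong (λ b → adj G i j ∧ (b ∧ out j)) (size≡0⇒false out |out| i)) (∧-zeroʳ (adj G i j)))

    edges≡covered : edgeCount G ≡ coveredEdgeCount G X
    edges≡covered = *-cancelˡ-≡ _ _ 2 (trans edges≡forest+covered (cong (_+ 2 * coveredEdgeCount G X) arcs-F))

    edges-pos : 0 < edgeCount G
    edges-pos = *-cancelˡ-≤ 2 (begin
      2                ≤⟨ proj₁ PR v ⟩
      degree G v       ≡⟨ degree≡deg G v ⟩
      deg G v          ≤⟨ term≤sum (deg G) v ⟩
      arcs G           ≡⟨ handshake G ⟩
      2 * edgeCount G  ∎)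
      where
      open ≤-Reasoning
      v = fromℕ< pos

lemma7 : (G : Graph) → 0 < n G → PropertyR G →
    (X : Subset (n G)) → FeedbackVertexSet G X →
    edgeCount G < 5 * coveredEdgeCount G X
lemma7 G pos PR X fvs with size (Covering.out G X) in |out|
... | zero  = all-covered PR pos |out|
  where open Covering G X
... | suc m = counting {nF = size out} (forest fvs |out|) (bad-forest PR fvs |out|) (degree-count PR) boundary≤covered
                       edges≡forest+covered
  where open Covering G X
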